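{- Let $r\ge2$ and $k_1,\ldots,k_r\ge2$. Then for every $n\ge1$, with $\zeta_n=e^{2\pi i/n}$, \[\sum_{j=1}^r\ \sum_{\substack{l_1,\ldots,l_{j-1}\ge2\\ l_j,\ldots,l_r\ge1}}\Big\{\prod_{p=1}^{j-1}\binom{k_p-2}{l_p-2}\Big\}\binom{k_j-2}{l_j-1}\Big\{\prod_{p=j+1}^r\binom{k_p-1}{l_p-1}\Big\}(1-\zeta_n)^{\sum_{p=1}^r(k_p-l_p)-1}\,\omega_n(l_1,\ldots,l_r;\zeta_n)=0;\] that is, the corresponding relation $\sum\cdots(1-\zeta)^{\sum_p(k_p-l_p)-1}\omega(l_1,\ldots,l_r)=0$ holds in $\mathcal{R}=\prod_{n\ge1}\mathbb{Q}(\zeta_n)$.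
   Context: For an index (tuple of positive integers) $\mathbf{l}=(l_1,\ldots,l_r)$ with $r\ge2$, $\omega_n(\mathbf{l};q)=\sum_{m_1+\cdots+m_r=n,\,m_i>0}\prod_{a=1}^r\frac{q^{(l_a-1)m_a}}{[m_a]^{l_a}}$ with $[m]=\frac{1-q^m}{1-q}$; since all $m_a<n$ it can be evaluated at a primitive $n$-th root of unity. In $\mathcal{R}=\prod_{n\ge1}\mathbb{Q}(\zeta_n)$, $\zeta=(\zeta_n)_n$ and $\omega(\mathbf{l})=(\omega_n(\mathbf{l};e^{2\pi i/n}))_n$. Binomial coefficients $\binom{a}{b}$ are zero unless $0\le b\le a$. -}

module Defs where

open import Level using (Level; _⊔_) renaming (suc to lsuc)
open import Algebra.Bundles using (CommutativeRing)
open import Data.Nat using (ℕ; zero; suc; _≤_; _<_; _∸_; _<ᵇ_; _≡ᵇ_; _≟_)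
  renaming (_+_ to _+ℕ_; _*_ to _*ℕ_)
open import Data.Nat.Combinatorics using (_C_)
open import Data.Integer using (ℤ; +_; -[1+_]; _⊖_)
open import Data.Fin using (Fin; toℕ) renaming (zero to fzero; suc to fsuc)
open import Data.Bool using (if_then_else_)
open import Data.List using (List; []; _∷_; map; concatMap; upTo; filter; foldr; allFin)
open import Data.Vec.Functional using (Vector) renaming (_∷_ to _∷ᵛ_)
open import Relation.Nullary using (¬_)
open import Data.Product using () renaming (_×_ to _×'_)

-- Generic binomial coefficient on integers: (a choose b), zero unless
-- 0 ≤ b ≤ a  (stdlib's _C_ already gives 0 when b > a).

binom : ℤ → ℤ → ℕ
binom (+ a) (+ b) = a C b
binom _     _     = 0

sumFin : ∀ {r} → (Fin r → ℕ) → ℕ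
sumFin {r} f = foldr _+ℕ_ 0 (map f (allFin r))

prodFin : ∀ {r} → (Fin r → ℕ) → ℕ
prodFin {r} f = foldr _*ℕ_ 1 (map f (allFin r))

box : (r : ℕ) → (Fin r → ℕ) → List (Fin r → ℕ)
box zero    k = (λ ()) ∷ []
box (suc r) k =
  concatMap (λ a → map (λ l → a ∷ᵛ l) (box r (λ p → k (fsuc p))))
            (map suc (upTo (k fzero)))

compositions : (r n : ℕ) → List (Fin r → ℕ)
compositions r n = filter (λ m → sumFin m ≟ n) (box r (λ _ → n))

-- Fields of characteristic zero (with a total inverse, x⁻¹ meaningful
-- for x ≉ 0) and primitive roots of unity.

module _ {c ℓ : Level} (R : CommutativeRing c ℓ) where
  open CommutativeRing R

  natCast : ℕ → Carrier
  natCast zero    = 0#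
  natCast (suc m) = 1# + natCast m

  pow : Carrier → ℕ → Carrier
  pow x zero    = 1#
  pow x (suc m) = x * pow x m

  sumK : List Carrier → Carrier
  sumK = foldr _+_ 0#

  prodK : List Carrier → Carrier
  prodK = foldr _*_ 1#

record CharZeroField (c ℓ : Level) : Set (lsuc (c ⊔ ℓ)) where
  field
    commutativeRing : CommutativeRing c ℓ
  open CommutativeRing commutativeRing public
  field
    _⁻¹        : Carrier → Carrier
    ⁻¹-inverse : ∀ x → ¬ (x ≈ 0#) → x * (x ⁻¹) ≈ 1#
    charZero   : ∀ m → ¬ (natCast commutativeRing (suc m) ≈ 0#)

module _ {c ℓ : Level} (F : CharZeroField c ℓ) where
  open CharZeroField F

  private
    _^_ = pow commutativeRing
    Σ   = sumK commutativeRing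
    Π   = prodK commutativeRing

  IsPrimitiveRoot : ℕ → Carrier → Set ℓ
  IsPrimitiveRoot n ζ = ((ζ ^ n) ≈ 1#) ×' (∀ m → 0 < m → m < n → ¬ ((ζ ^ m) ≈ 1#))

  qint : Carrier → ℕ → Carrier
  qint q m = (1# - (q ^ m)) * ((1# - q) ⁻¹)

  omega : (n : ℕ) → {r : ℕ} → (Fin r → ℕ) → Carrier → Carrier
  omega n {r} l q =
    Σ (map (λ m → Π (map (λ a → (q ^ ((l a ∸ 1) *ℕ m a)) * ((qint q (m a) ^ l a) ⁻¹))
                         (allFin r)))
           (compositions r n))

  coeff : {r : ℕ} → (k : Fin r → ℕ) → (j : Fin r) → (l : Fin r → ℕ) → ℕ
  coeff k j l = prodFin (λ p →
    if toℕ p <ᵇ toℕ j then binom (k p ⊖ 2) (l p ⊖ 2)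
    else if toℕ p ≡ᵇ toℕ j then binom (k p ⊖ 2) (l p ⊖ 1)
    else binom (k p ⊖ 1) (l p ⊖ 1))

  -- The left-hand side of Theorem 5.1 at level n, evaluated at ζ.
  -- The inner sum over l_1,…,l_r ranges over 1 ≤ l_p ≤ k_p; outside this
  -- box all binomial coefficients vanish.
  relationLHS : (n : ℕ) → {r : ℕ} → (Fin r → ℕ) → Carrier → Carrier
  relationLHS n {r} k ζ =
    Σ (map (λ j →
      Σ (map (λ l →
          natCast commutativeRing (coeff k j l)
          * (((1# - ζ) ^ ((sumFin k ∸ sumFin l) ∸ 1)) * omega n l ζ))
        (box r k)))
      (allFin r))

module Submission where

-- Expanding ω_n(l; ζ) as a sum over compositions m of n and exchanging the
-- order of summation, it suffices to show that the contributions of each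
-- single composition m cancel.  Put t = 1 - ζ, A_a = 1/[m_a] and
-- B_a = ζ^{m_a}/[m_a]; then A_a = B_a + t and ζ^{(x-1)m_a}/[m_a]^x = A_a B_a^{x-1}.
-- After multiplying by t ≠ 0 the sum over l factorises over the coordinates,
-- and by the binomial theorem the coordinate a contributes B_a A_a^{k_a-1},
-- t A_a^{k_a-1} or A_a^{k_a} according as a lies before, at or after j.  The
-- sum over j then telescopes to a multiple of Π A - Π B, which is 0 as ζ^n = 1.

open import Defs
open import Level using (Level)
open import Data.Nat using (ℕ; _≤_)
open import Data.Fin using (Fin)

open import Algebra.Bundles using (CommutativeRing)
import Data.Nat as ℕ
open import Data.Nat using (zero; suc; _<_; z≤n; s≤s; _∸_)
import Data.Nat.Properties as ℕ
open import Data.Nat.Properties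
  using (≤-trans; ≤-antisym; ≮⇒≥; m≤m+n; m≤n+m; m<m+n; +-mono-≤; +-∸-comm; +-∸-assoc; ∸-+-assoc; m<n⇒0<n∸m)
open import Data.Nat.Combinatorics using (_C_)
open import Data.Nat.Combinatorics.Specification using (k>n⇒nCk≡0)
open import Data.Fin using (toℕ; fromℕ; inject₁) renaming (zero to fzero; suc to fsuc)
open import Data.Fin.Properties using (toℕ-fromℕ; toℕ-inject₁)
open import Data.Bool using (Bool; true; false; if_then_else_)
open import Data.Integer using (_⊖_)
open import Data.List as List using (List; []; _∷_; _++_; upTo; applyUpTo; allFin)
import Data.List.Properties as List
open import Data.List.Relation.Unary.All as All using (All; []; _∷_)
import Data.List.Relation.Unary.All.Properties as All
import Data.Vec.Functional as Vec
open import Data.Vec.Functional using () renaming (_∷_ to _∷ᵛ_)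
open import Data.Product using (_,_; proj₁; proj₂) renaming (_×_ to _∧_)
open import Data.Sum using (_⊎_; inj₁; inj₂)
open import Function using (id; _∘_)
open import Relation.Nullary using (¬_; yes; no)
import Relation.Binary.PropositionalEquality as ≡
open ≡ using (_≡_)

foldr-allFin : ∀ {a} {A : Set a} (_∙_ : A → A → A) (e : A) {r} (f : Fin r → A) →
  List.foldr _∙_ e (List.map f (allFin r)) ≡ Vec.foldr _∙_ e f
foldr-allFin _∙_ e {r} f = ≡.trans (≡.cong (List.foldr _∙_ e) (List.map-tabulate id f)) (go f)
  where
  go : ∀ {r} (g : Fin r → _) → List.foldr _∙_ e (List.tabulate g) ≡ Vec.foldr _∙_ e g
  go {zero}  g = ≡.refl
  go {suc r} g = ≡.cong (g fzero ∙_) (go (g ∘ fsuc))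

∑ℕ : ∀ {r} → (Fin r → ℕ) → ℕ
∑ℕ = Vec.foldr ℕ._+_ 0

∏ℕ : ∀ {r} → (Fin r → ℕ) → ℕ
∏ℕ = Vec.foldr ℕ._*_ 1

part≤∑ℕ : ∀ {r} (f : Fin r → ℕ) a → f a ≤ ∑ℕ f
part≤∑ℕ f fzero    = m≤m+n _ _
part≤∑ℕ f (fsuc a) = ≤-trans (part≤∑ℕ (f ∘ fsuc) a) (m≤n+m _ (f fzero))

∑ℕ-mono : ∀ {r} (l k : Fin r → ℕ) → (∀ a → l a ≤ k a) → ∑ℕ l ≤ ∑ℕ k
∑ℕ-mono {zero}  l k l≤k = z≤n
∑ℕ-mono {suc r} l k l≤k = +-mono-≤ (l≤k fzero) (∑ℕ-mono (l ∘ fsuc) (k ∘ fsuc) (l≤k ∘ fsuc))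

∑ℕ-∸ : ∀ {r} (k l : Fin r → ℕ) → (∀ a → l a ≤ k a) → ∑ℕ k ∸ ∑ℕ l ≡ ∑ℕ (λ a → k a ∸ l a)
∑ℕ-∸ {zero}  k l l≤k = ≡.refl
∑ℕ-∸ {suc r} k l l≤k = begin
  (k₀ ℕ.+ K) ∸ (l₀ ℕ.+ L)   ≡⟨ ≡.sym (∸-+-assoc (k₀ ℕ.+ K) l₀ L) ⟩
  (k₀ ℕ.+ K) ∸ l₀ ∸ L       ≡⟨ ≡.cong (_∸ L) (+-∸-comm K (l≤k fzero)) ⟩
  (k₀ ∸ l₀) ℕ.+ K ∸ L       ≡⟨ +-∸-assoc (k₀ ∸ l₀) (∑ℕ-mono (l ∘ fsuc) (k ∘ fsuc) (l≤k ∘ fsuc)) ⟩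
  (k₀ ∸ l₀) ℕ.+ (K ∸ L)     ≡⟨ ≡.cong ((k₀ ∸ l₀) ℕ.+_) (∑ℕ-∸ (k ∘ fsuc) (l ∘ fsuc) (l≤k ∘ fsuc)) ⟩
  ∑ℕ (λ a → k a ∸ l a)      ∎
  where
  open ≡.≡-Reasoning
  k₀ = k fzero
  l₀ = l fzero
  K = ∑ℕ (k ∘ fsuc)
  L = ∑ℕ (l ∘ fsuc)

part<∑ℕ : ∀ {r} (m : Fin (suc (suc r)) → ℕ) → (∀ a → 1 ≤ m a) → ∀ a → m a < ∑ℕ m
part<∑ℕ m pos fzero    = m<m+n (m fzero) (≤-trans (pos (fsuc fzero)) (part≤∑ℕ (m ∘ fsuc) fzero))
part<∑ℕ m pos (fsuc a) = +-mono-≤ (pos fzero) (part≤∑ℕ (m ∘ fsuc) a)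

∏ℕ-zero : ∀ {r} (f : Fin r → ℕ) j → f j ≡ 0 → ∏ℕ f ≡ 0
∏ℕ-zero f fzero    f₀≡0 = ≡.cong (ℕ._* ∏ℕ (f ∘ fsuc)) f₀≡0
∏ℕ-zero f (fsuc j) fj≡0 = ≡.trans (≡.cong (f fzero ℕ.*_) (∏ℕ-zero (f ∘ fsuc) j fj≡0)) (ℕ.*-zeroʳ (f fzero))

choose : ∀ {ℓ} {A : Set ℓ} → Bool → Bool → A → A → A → A
choose b₁ b₂ x y z = if b₁ then x else (if b₂ then y else z)

bySide : ∀ {ℓ} {A : Set ℓ} {r} → Fin r → Fin r → A → A → A → A
bySide j a = choose (toℕ a ℕ.<ᵇ toℕ j) (toℕ a ℕ.≡ᵇ toℕ j)

bySide-at : ∀ {ℓ} {A : Set ℓ} {r} (j : Fin r) (x y z : A) → bySide j j x y z ≡ y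
bySide-at j x y z = go (toℕ j)
  where
  go : ∀ n → choose (n ℕ.<ᵇ n) (n ℕ.≡ᵇ n) x y z ≡ y
  go zero    = ≡.refl
  go (suc n) = go n

-- The a-th factor of the j-th coefficient of Theorem 5.1, so that
-- coeff F k j l is definitionally prodFin (λ a → binomSel k j a (l a)).
binomSel : ∀ {r} → (Fin r → ℕ) → Fin r → Fin r → ℕ → ℕ
binomSel k j a x = bySide j a (binom (k a ⊖ 2) (x ⊖ 2)) (binom (k a ⊖ 2) (x ⊖ 1)) (binom (k a ⊖ 1) (x ⊖ 1))

binomSel-top : ∀ {r} (k : Fin r → ℕ) j → 2 ≤ k j → binomSel k j j (k j) ≡ 0
binomSel-top k j 2≤kj = ≡.trans (bySide-at j _ _ _) (vanish (k j) 2≤kj)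
  where
  vanish : ∀ K → 2 ≤ K → binom (K ⊖ 2) (K ⊖ 1) ≡ 0
  vanish (suc (suc K)) (s≤s (s≤s _)) = k>n⇒nCk≡0 (ℕ.n<1+n K)

InBox : ∀ {r} → (Fin r → ℕ) → (Fin r → ℕ) → Set
InBox k l = ∀ a → 1 ≤ l a ∧ l a ≤ k a

box-InBox : ∀ r (k : Fin r → ℕ) → All (InBox k) (box r k)
box-InBox zero    k = (λ ()) ∷ []
box-InBox (suc r) k = All.concat⁺ (All.map⁺ (All.map prepend heads))
  where
  heads : All (λ x → 1 ≤ x ∧ x ≤ k fzero) (List.map suc (upTo (k fzero)))
  heads = All.map⁺ (All.applyUpTo⁺₁ id (k fzero) (λ i<k → s≤s z≤n , i<k))
  prepend : ∀ {x} → 1 ≤ x ∧ x ≤ k fzero → All (InBox k) (List.map (x ∷ᵛ_) (box r (k ∘ fsuc)))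
  prepend x-ok = All.map⁺ (All.map (λ l-ok → λ { fzero → x-ok ; (fsuc a) → l-ok a }) (box-InBox r (k ∘ fsuc)))

IsComposition : ∀ {r} → ℕ → (Fin r → ℕ) → Set
IsComposition n m = sumFin m ≡ n ∧ (∀ a → 1 ≤ m a)

compositions-valid : ∀ r n → All (IsComposition n) (compositions r n)
compositions-valid r n =
  All.zipWith (λ (sum≡n , inBox) → sum≡n , proj₁ ∘ inBox)
    (All.all-filter (λ m → sumFin m ℕ.≟ n) (box r (λ _ → n)) ,
     All.filter⁺ (λ m → sumFin m ℕ.≟ n) (box-InBox r (λ _ → n)))

module InCommutativeRing {a ℓ : Level} (R : CommutativeRing a ℓ) where
  open CommutativeRing R
  open import Relation.Binary.Reasoning.Setoid setoid
  open import Algebra.Properties.Semiring.Sum semiring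
    using (sum; sum-syntax; sum-cong-≋; *-distribˡ-sum; sum-init-last)
  open import Algebra.Properties.CommutativeMonoid.Sum *-commutativeMonoid
    using () renaming (sum to ∏; ∑-distrib-+ to ∏-distrib-*; sum-cong-≋ to ∏-cong)
  open import Algebra.Properties.Semiring.Exp semiring using (_^_; ^-homo-*; ^-congˡ)
  open import Algebra.Properties.Semiring.Mult semiring using (_×_; ×-assoc-*; ×-congʳ; ×1-homo-*)
  import Algebra.Properties.CommutativeSemiring.Binomial commutativeSemiring as Binomial
  open import Algebra.Solver.Ring.NaturalCoefficients.Default commutativeSemiring

  Σ : List Carrier → Carrier
  Σ = sumK R

  Π : List Carrier → Carrier
  Π = prodK R

  nc : ℕ → Carrier
  nc = natCast R

  pow≡^ : ∀ x n → pow R x n ≡ x ^ n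
  pow≡^ x zero    = ≡.refl
  pow≡^ x (suc n) = ≡.cong (x *_) (pow≡^ x n)

  nc≡×1 : ∀ m → nc m ≡ m × 1#
  nc≡×1 zero    = ≡.refl
  nc≡×1 (suc m) = ≡.cong (1# +_) (nc≡×1 m)

  nc-* : ∀ m x → nc m * x ≈ m × x
  nc-* m x = trans (*-congʳ (reflexive (nc≡×1 m))) (trans (×-assoc-* m 1# x) (×-congʳ m (*-identityˡ x)))

  nc-∏ℕ : ∀ {r} (f : Fin r → ℕ) → nc (∏ℕ f) ≈ ∏ (nc ∘ f)
  nc-∏ℕ {zero}  f = +-identityʳ 1#
  nc-∏ℕ {suc r} f = begin
    nc (f fzero ℕ.* ∏ℕ (f ∘ fsuc))          ≡⟨ nc≡×1 (f fzero ℕ.* ∏ℕ (f ∘ fsuc)) ⟩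
    (f fzero ℕ.* ∏ℕ (f ∘ fsuc)) × 1#        ≈⟨ ×1-homo-* (f fzero) _ ⟩
    (f fzero × 1#) * (∏ℕ (f ∘ fsuc) × 1#)   ≡⟨ ≡.sym (≡.cong₂ _*_ (nc≡×1 (f fzero)) (nc≡×1 (∏ℕ (f ∘ fsuc)))) ⟩
    nc (f fzero) * nc (∏ℕ (f ∘ fsuc))       ≈⟨ *-congˡ (nc-∏ℕ (f ∘ fsuc)) ⟩
    ∏ (nc ∘ f)                              ∎

  ^-∑ℕ : ∀ {r} x (e : Fin r → ℕ) → x ^ ∑ℕ e ≈ ∏ (λ a → x ^ e a)
  ^-∑ℕ {zero}  x e = refl
  ^-∑ℕ {suc r} x e = trans (^-homo-* x (e fzero) _) (*-congˡ (^-∑ℕ x (e ∘ fsuc)))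

  ^-inverse : ∀ {x y} → x * y ≈ 1# → ∀ s → x ^ s * y ^ s ≈ 1#
  ^-inverse x*y≈1 zero    = *-identityˡ 1#
  ^-inverse {x} {y} x*y≈1 (suc s) = begin
    (x * x ^ s) * (y * y ^ s)   ≈⟨ solve 4 (λ x x′ y y′ → (x :* x′) :* (y :* y′) := (x :* y) :* (x′ :* y′)) refl x _ y _ ⟩
    (x * y) * (x ^ s * y ^ s)   ≈⟨ *-cong x*y≈1 (^-inverse x*y≈1 s) ⟩
    1# * 1#                     ≈⟨ *-identityˡ 1# ⟩
    1#                          ∎

  +-cancel-0 : ∀ X G → X + G ≈ G → X ≈ 0#
  +-cancel-0 X G X+G≈G = begin
    X              ≈⟨ +-identityʳ X ⟨
    X + 0#         ≈⟨ +-congˡ (-‿inverseʳ G) ⟨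
    X + (G - G)    ≈⟨ +-assoc X G (- G) ⟨
    (X + G) - G    ≈⟨ +-congʳ X+G≈G ⟩
    G - G          ≈⟨ -‿inverseʳ G ⟩
    0#             ∎

  Σ-cong : ∀ {A : Set} {f g : A → Carrier} (xs : List A) → (∀ x → f x ≈ g x) →
    Σ (List.map f xs) ≈ Σ (List.map g xs)
  Σ-cong []       f≈g = refl
  Σ-cong (x ∷ xs) f≈g = +-cong (f≈g x) (Σ-cong xs f≈g)

  Σ-congᴬ : ∀ {A : Set} {f g : A → Carrier} {xs : List A} → All (λ x → f x ≈ g x) xs →
    Σ (List.map f xs) ≈ Σ (List.map g xs)
  Σ-congᴬ []            = refl
  Σ-congᴬ (fx≈gx ∷ f≈g) = +-cong fx≈gx (Σ-congᴬ f≈g)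

  Σ-zeroᴬ : ∀ {A : Set} {f : A → Carrier} {xs : List A} → All (λ x → f x ≈ 0#) xs →
    Σ (List.map f xs) ≈ 0#
  Σ-zeroᴬ []            = refl
  Σ-zeroᴬ (fx≈0 ∷ f≈0) = trans (+-cong fx≈0 (Σ-zeroᴬ f≈0)) (+-identityˡ 0#)

  Σ-*ˡ : ∀ {A : Set} a (f : A → Carrier) (xs : List A) →
    a * Σ (List.map f xs) ≈ Σ (List.map (λ x → a * f x) xs)
  Σ-*ˡ a f []       = zeroʳ a
  Σ-*ˡ a f (x ∷ xs) = trans (distribˡ a (f x) _) (+-congˡ (Σ-*ˡ a f xs))

  Σ-*ʳ : ∀ {A : Set} a (f : A → Carrier) (xs : List A) →
    Σ (List.map f xs) * a ≈ Σ (List.map (λ x → f x * a) xs)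
  Σ-*ʳ a f []       = zeroˡ a
  Σ-*ʳ a f (x ∷ xs) = trans (distribʳ a (f x) _) (+-congˡ (Σ-*ʳ a f xs))

  Σ-+ : ∀ {A : Set} (f g : A → Carrier) (xs : List A) →
    Σ (List.map (λ x → f x + g x) xs) ≈ Σ (List.map f xs) + Σ (List.map g xs)
  Σ-+ f g []       = sym (+-identityˡ 0#)
  Σ-+ f g (x ∷ xs) = trans (+-congˡ (Σ-+ f g xs))
    (solve 4 (λ a b c d → (a :+ b) :+ (c :+ d) := (a :+ c) :+ (b :+ d)) refl (f x) (g x) _ _)

  Σ-swap : ∀ {A B : Set} (f : A → B → Carrier) (xs : List A) (ys : List B) →
    Σ (List.map (λ x → Σ (List.map (f x) ys)) xs) ≈ Σ (List.map (λ y → Σ (List.map (λ x → f x y) xs)) ys)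
  Σ-swap f []       ys = sym (Σ-zeroᴬ (All.universal (λ _ → refl) ys))
  Σ-swap f (x ∷ xs) ys = trans (+-congˡ (Σ-swap f xs ys)) (sym (Σ-+ (f x) _ ys))

  Σ-++ : ∀ {A : Set} (f : A → Carrier) (xs ys : List A) →
    Σ (List.map f (xs ++ ys)) ≈ Σ (List.map f xs) + Σ (List.map f ys)
  Σ-++ f []       ys = sym (+-identityˡ _)
  Σ-++ f (x ∷ xs) ys = trans (+-congˡ (Σ-++ f xs ys)) (sym (+-assoc _ _ _))

  Σ-concatMap : ∀ {A B : Set} (f : B → Carrier) (h : A → List B) (xs : List A) →
    Σ (List.map f (List.concatMap h xs)) ≈ Σ (List.map (λ x → Σ (List.map f (h x))) xs)
  Σ-concatMap f h []       = refl
  Σ-concatMap f h (x ∷ xs) = trans (Σ-++ f (h x) (List.concatMap h xs)) (+-congˡ (Σ-concatMap f h xs))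

  Σ-range : ∀ (f : ℕ → Carrier) K → Σ (List.map f (List.map suc (upTo K))) ≡ ∑[ i < K ] f (suc (toℕ i))
  Σ-range f K = ≡.trans (≡.cong (Σ ∘ List.map f) (List.map-applyUpTo (λ i → i) suc K)) (go suc K)
    where
    go : ∀ (h : ℕ → ℕ) K → Σ (List.map f (applyUpTo h K)) ≡ ∑[ i < K ] f (h (toℕ i))
    go h zero    = ≡.refl
    go h (suc K) = ≡.cong (f (h 0) +_) (go (h ∘ suc) K)

  binomialTerm : Carrier → Carrier → ℕ → ℕ → Carrier
  binomialTerm x y N i = nc (N C i) * (x ^ i * y ^ (N ∸ i))

  binomial-theorem : ∀ x y N → ∑[ i < suc N ] binomialTerm x y N (toℕ i) ≈ (x + y) ^ N
  binomial-theorem x y N =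
    trans (sum-cong-≋ {suc N} (λ i → nc-* (N C toℕ i) (x ^ toℕ i * y ^ (N ∸ toℕ i)))) (sym (Binomial.theorem N x y))

  -- The expansion may run one index further, since C(N, N+1) = 0.
  binomial-theorem⁺ : ∀ x y N → ∑[ i < suc (suc N) ] binomialTerm x y N (toℕ i) ≈ (x + y) ^ N
  binomial-theorem⁺ x y N = begin
    ∑[ i < suc (suc N) ] T (toℕ i)                                 ≈⟨ sum-init-last {suc N} (T ∘ toℕ) ⟩
    ∑[ i < suc N ] T (toℕ (inject₁ i)) + T (toℕ (fromℕ (suc N)))   ≈⟨ +-cong (sum-cong-≋ {suc N} (λ i → reflexive (≡.cong T (toℕ-inject₁ i)))) last≈0 ⟩
    ∑[ i < suc N ] T (toℕ i) + 0#                                  ≈⟨ +-identityʳ _ ⟩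
    ∑[ i < suc N ] T (toℕ i)                                       ≈⟨ binomial-theorem x y N ⟩
    (x + y) ^ N                                                    ∎
    where
    T = binomialTerm x y N
    last≈0 : T (toℕ (fromℕ (suc N))) ≈ 0#
    last≈0 = trans (*-congʳ (reflexive (≡.cong nc C≡0))) (zeroˡ _)
      where
      C≡0 : N C toℕ (fromℕ (suc N)) ≡ 0
      C≡0 = ≡.trans (≡.cong (N C_) (toℕ-fromℕ (suc N))) (k>n⇒nCk≡0 (ℕ.n<1+n N))

  -- One coordinate of Theorem 5.1.  When A ≈ B + t and p (i+1) ≈ A·B^i, each
  -- of the three binomially weighted sums Σ_{x=1}^{K} c(x) t^{K-x} p(x)
  -- occurring in the theorem is, by the binomial theorem, a multiple of A^{K-1}.
  module Coordinate (t A B : Carrier) (p : ℕ → Carrier)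
                    (A≈B+t : A ≈ B + t) (p-suc : ∀ i → p (suc i) ≈ A * B ^ i) where

    weightedSum : (ℕ → ℕ) → ℕ → Carrier
    weightedSum c K = Σ (List.map (λ x → nc (c x) * (t ^ (K ∸ x) * p x)) (List.map suc (upTo K)))

    expansion : ∀ N → ∑[ i < suc N ] binomialTerm B t N (toℕ i) ≈ A ^ N
    expansion N = trans (binomial-theorem B t N) (^-congˡ N (sym A≈B+t))

    after-sum : ∀ N → weightedSum (λ x → binom (suc N ⊖ 1) (x ⊖ 1)) (suc N) ≈ A ^ suc N
    after-sum N = begin
      weightedSum (λ x → binom (suc N ⊖ 1) (x ⊖ 1)) (suc N)
        ≡⟨ Σ-range _ (suc N) ⟩
      ∑[ i < suc N ] (nc (N C toℕ i) * (t ^ (N ∸ toℕ i) * p (suc (toℕ i))))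
        ≈⟨ sum-cong-≋ {suc N} (λ i → factor (toℕ i)) ⟩
      ∑[ i < suc N ] (A * binomialTerm B t N (toℕ i))
        ≈⟨ *-distribˡ-sum {suc N} A (binomialTerm B t N ∘ toℕ) ⟨
      A * ∑[ i < suc N ] binomialTerm B t N (toℕ i)
        ≈⟨ *-congˡ (expansion N) ⟩
      A * A ^ N ∎
      where
      factor : ∀ i → nc (N C i) * (t ^ (N ∸ i) * p (suc i)) ≈ A * binomialTerm B t N i
      factor i = trans (*-congˡ (*-congˡ (p-suc i)))
        (solve 4 (λ c y a b → c :* (y :* (a :* b)) := a :* (c :* (b :* y))) refl (nc (N C i)) (t ^ (N ∸ i)) A (B ^ i))

    at-sum : ∀ N → weightedSum (λ x → binom (suc (suc N) ⊖ 2) (x ⊖ 1)) (suc (suc N)) ≈ t * A ^ suc N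
    at-sum N = begin
      weightedSum (λ x → binom (suc (suc N) ⊖ 2) (x ⊖ 1)) (suc (suc N))
        ≡⟨ Σ-range _ (suc (suc N)) ⟩
      ∑[ i < suc (suc N) ] (nc (N C toℕ i) * (t ^ (suc N ∸ toℕ i) * p (suc (toℕ i))))
        ≈⟨ sum-cong-≋ {suc (suc N)} (λ i → factor (toℕ i)) ⟩
      ∑[ i < suc (suc N) ] ((t * A) * binomialTerm B t N (toℕ i))
        ≈⟨ *-distribˡ-sum {suc (suc N)} (t * A) (binomialTerm B t N ∘ toℕ) ⟨
      (t * A) * ∑[ i < suc (suc N) ] binomialTerm B t N (toℕ i)
        ≈⟨ *-congˡ (trans (binomial-theorem⁺ B t N) (^-congˡ N (sym A≈B+t))) ⟩
      (t * A) * A ^ N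
        ≈⟨ *-assoc t A (A ^ N) ⟩
      t * A ^ suc N ∎
      where
      factor : ∀ i → nc (N C i) * (t ^ (suc N ∸ i) * p (suc i)) ≈ (t * A) * binomialTerm B t N i
      factor i with i ℕ.≤? N
      ... | yes i≤N = trans (*-congˡ (*-cong (reflexive (≡.cong (t ^_) (+-∸-assoc 1 i≤N))) (p-suc i)))
        (solve 5 (λ c t y a b → c :* ((t :* y) :* (a :* b)) := (t :* a) :* (c :* (b :* y)))
               refl (nc (N C i)) t (t ^ (N ∸ i)) A (B ^ i))
      ... | no i≰N = trans (*-congʳ C≈0) (trans (zeroˡ _) (sym (trans (*-congˡ (*-congʳ C≈0)) (trans (*-congˡ (zeroˡ _)) (zeroʳ _)))))
        where
        C≈0 : nc (N C i) ≈ 0#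
        C≈0 = reflexive (≡.cong nc (k>n⇒nCk≡0 (ℕ.≰⇒> i≰N)))

    before-sum : ∀ N → weightedSum (λ x → binom (suc (suc N) ⊖ 2) (x ⊖ 2)) (suc (suc N)) ≈ B * A ^ suc N
    before-sum N = begin
      weightedSum (λ x → binom (suc (suc N) ⊖ 2) (x ⊖ 2)) (suc (suc N))
        ≡⟨ Σ-range _ (suc (suc N)) ⟩
      f 1 + ∑[ i < suc N ] (nc (N C toℕ i) * (t ^ (N ∸ toℕ i) * p (suc (suc (toℕ i)))))
        ≈⟨ +-cong (zeroˡ _) (sum-cong-≋ {suc N} (λ i → factor (toℕ i))) ⟩
      0# + ∑[ i < suc N ] ((A * B) * binomialTerm B t N (toℕ i))
        ≈⟨ +-identityˡ _ ⟩
      ∑[ i < suc N ] ((A * B) * binomialTerm B t N (toℕ i))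
        ≈⟨ *-distribˡ-sum {suc N} (A * B) (binomialTerm B t N ∘ toℕ) ⟨
      (A * B) * ∑[ i < suc N ] binomialTerm B t N (toℕ i)
        ≈⟨ *-congˡ (expansion N) ⟩
      (A * B) * A ^ N
        ≈⟨ solve 3 (λ a b z → (a :* b) :* z := b :* (a :* z)) refl A B (A ^ N) ⟩
      B * A ^ suc N ∎
      where
      f : ℕ → Carrier
      f x = nc (binom (suc (suc N) ⊖ 2) (x ⊖ 2)) * (t ^ (suc (suc N) ∸ x) * p x)
      factor : ∀ i → nc (N C i) * (t ^ (N ∸ i) * p (suc (suc i))) ≈ (A * B) * binomialTerm B t N i
      factor i = trans (*-congˡ (*-congˡ (p-suc (suc i))))
        (solve 5 (λ c y a b z → c :* (y :* (a :* (b :* z))) := (a :* b) :* (c :* (z :* y)))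
               refl (nc (N C i)) (t ^ (N ∸ i)) A B (B ^ i))

    coordinate-sum : ∀ b₁ b₂ K → 2 ≤ K →
      weightedSum (λ x → choose b₁ b₂ (binom (K ⊖ 2) (x ⊖ 2)) (binom (K ⊖ 2) (x ⊖ 1)) (binom (K ⊖ 1) (x ⊖ 1))) K
        ≈ choose b₁ b₂ (B * A ^ (K ∸ 1)) (t * A ^ (K ∸ 1)) (A ^ K)
    coordinate-sum true  _     (suc (suc N)) (s≤s (s≤s _)) = before-sum N
    coordinate-sum false true  (suc (suc N)) (s≤s (s≤s _)) = at-sum N
    coordinate-sum false false (suc (suc N)) (s≤s (s≤s _)) = after-sum (suc N)

  box-factorise : ∀ r (k : Fin r → ℕ) (G : Fin r → ℕ → Carrier) →
    Σ (List.map (λ l → ∏ (λ a → G a (l a))) (box r k)) ≈ ∏ (λ a → Σ (List.map (G a) (List.map suc (upTo (k a)))))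
  box-factorise zero    k G = +-identityʳ 1#
  box-factorise (suc r) k G = begin
    Σ (List.map F (List.concatMap row xs))
      ≈⟨ Σ-concatMap F row xs ⟩
    Σ (List.map (λ x → Σ (List.map F (row x))) xs)
      ≈⟨ Σ-cong xs (λ x → trans (reflexive (≡.cong Σ (≡.sym (List.map-∘ (box r k′)))))
                                (sym (Σ-*ˡ (G fzero x) F′ (box r k′)))) ⟩
    Σ (List.map (λ x → G fzero x * Σ (List.map F′ (box r k′))) xs)
      ≈⟨ Σ-*ʳ _ (G fzero) xs ⟨
    Σ (List.map (G fzero) xs) * Σ (List.map F′ (box r k′))
      ≈⟨ *-congˡ (box-factorise r k′ (G ∘ fsuc)) ⟩
    ∏ (λ a → Σ (List.map (G a) (List.map suc (upTo (k a))))) ∎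
    where
    k′ = k ∘ fsuc
    xs = List.map suc (upTo (k fzero))
    row : ℕ → List (Fin (suc r) → ℕ)
    row x = List.map (x ∷ᵛ_) (box r k′)
    F : (Fin (suc r) → ℕ) → Carrier
    F l = ∏ (λ a → G a (l a))
    F′ : (Fin r → ℕ) → Carrier
    F′ l = ∏ (λ a → G (fsuc a) (l a))

  telescope : ∀ {r} (lt d gt : Fin r → Carrier) → (∀ a → d a + lt a ≈ gt a) →
    ∑[ j < r ] ∏ (λ a → bySide j a (lt a) (d a) (gt a)) + ∏ lt ≈ ∏ gt
  telescope {zero}  lt d gt step = +-identityˡ 1#
  telescope {suc r} lt d gt step = begin
    (d₀ * G + ∑[ j < r ] (lt₀ * S j)) + lt₀ * L
      ≈⟨ +-congʳ (+-congˡ (*-distribˡ-sum {r} lt₀ S)) ⟨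
    (d₀ * G + lt₀ * ∑[ j < r ] S j) + lt₀ * L
      ≈⟨ solve 5 (λ d g l s m → (d :* g :+ l :* s) :+ l :* m := d :* g :+ l :* (s :+ m)) refl d₀ G lt₀ (∑[ j < r ] S j) L ⟩
    d₀ * G + lt₀ * (∑[ j < r ] S j + L)
      ≈⟨ +-congˡ (*-congˡ (telescope (lt ∘ fsuc) (d ∘ fsuc) (gt ∘ fsuc) (step ∘ fsuc))) ⟩
    d₀ * G + lt₀ * G
      ≈⟨ distribʳ G d₀ lt₀ ⟨
    (d₀ + lt₀) * G
      ≈⟨ *-congʳ (step fzero) ⟩
    gt fzero * G ∎
    where
    d₀ = d fzero
    lt₀ = lt fzero
    G = ∏ (gt ∘ fsuc)
    L = ∏ (lt ∘ fsuc)
    S : Fin r → Carrier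
    S j = ∏ (λ a → bySide j a (lt (fsuc a)) (d (fsuc a)) (gt (fsuc a)))

  -- Here
  -- p a x stands for ζ^{(x-1)m_a}/[m_a]^x and A a = 1/[m_a], B a = ζ^{m_a}/[m_a].
  -- Multiplying the (j, l)-sum by t turns it into a sum of coordinatewise
  -- products; factorising over the box, evaluating each coordinate sum and
  -- telescoping over j leaves a multiple of Π A - Π B, which vanishes by hypothesis.
  module ForComposition {r} (k : Fin r → ℕ) (2≤k : ∀ a → 2 ≤ k a)
      (t : Carrier) (A B : Fin r → Carrier) (p : Fin r → ℕ → Carrier)
      (A≈B+t : ∀ a → A a ≈ B a + t) (p-suc : ∀ a i → p a (suc i) ≈ A a * B a ^ i)
      (∏B≈∏A : ∏ B ≈ ∏ A) where

    summand : Fin r → (Fin r → ℕ) → Carrier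
    summand j l = nc (∏ℕ (λ a → binomSel k j a (l a))) * (t ^ ((sumFin k ∸ sumFin l) ∸ 1) * ∏ (λ a → p a (l a)))

    weight : Fin r → Fin r → ℕ → Carrier
    weight j a x = nc (binomSel k j a x) * (t ^ (k a ∸ x) * p a x)

    -- An extra factor t restores a lowered exponent D - 1, unless D = 0,
    -- in which case the coefficient must vanish.
    restore : ∀ c D → c ≡ 0 ⊎ 1 ≤ D → nc c * (t * t ^ (D ∸ 1)) ≈ nc c * t ^ D
    restore c D       (inj₁ c≡0) = trans nc-c≈0 (sym nc-c≈0)
      where
      nc-c≈0 : ∀ {X} → nc c * X ≈ 0#
      nc-c≈0 = trans (*-congʳ (reflexive (≡.cong nc c≡0))) (zeroˡ _)
    restore c (suc D) (inj₂ _)   = refl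

    t-summand : ∀ j l → InBox k l → t * summand j l ≈ ∏ (λ a → weight j a (l a))
    t-summand j l l∈box = begin
      t * (nc c * (t ^ (E ∸ 1) * P))
        ≈⟨ solve 4 (λ t c y p → t :* (c :* (y :* p)) := (c :* (t :* y)) :* p) refl t (nc c) (t ^ (E ∸ 1)) P ⟩
      (nc c * (t * t ^ (E ∸ 1))) * P
        ≈⟨ *-congʳ (restore c E zero-or-positive) ⟩
      (nc c * t ^ E) * P
        ≈⟨ *-congʳ (*-cong (nc-∏ℕ (λ a → binomSel k j a (l a))) (trans (reflexive (≡.cong (t ^_) E≡D)) (^-∑ℕ t (λ a → k a ∸ l a)))) ⟩
      (∏ (λ a → nc (binomSel k j a (l a))) * ∏ (λ a → t ^ (k a ∸ l a))) * P
        ≈⟨ *-assoc _ _ P ⟩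
      ∏ (λ a → nc (binomSel k j a (l a))) * (∏ (λ a → t ^ (k a ∸ l a)) * P)
        ≈⟨ *-congˡ (∏-distrib-* {r} (λ a → t ^ (k a ∸ l a)) (λ a → p a (l a))) ⟨
      ∏ (λ a → nc (binomSel k j a (l a))) * ∏ (λ a → t ^ (k a ∸ l a) * p a (l a))
        ≈⟨ ∏-distrib-* {r} (λ a → nc (binomSel k j a (l a))) (λ a → t ^ (k a ∸ l a) * p a (l a)) ⟨
      ∏ (λ a → weight j a (l a)) ∎
      where
      c = ∏ℕ (λ a → binomSel k j a (l a))
      E = sumFin k ∸ sumFin l
      P = ∏ (λ a → p a (l a))
      E≡D : E ≡ ∑ℕ (λ a → k a ∸ l a)
      E≡D = ≡.trans (≡.cong₂ _∸_ (foldr-allFin ℕ._+_ 0 k) (foldr-allFin ℕ._+_ 0 l)) (∑ℕ-∸ k l (proj₂ ∘ l∈box))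
      zero-or-positive : c ≡ 0 ⊎ 1 ≤ E
      zero-or-positive with l j ℕ.<? k j
      ... | yes lj<kj = inj₂ (≡.subst (1 ≤_) (≡.sym E≡D) (ℕ.≤-trans (m<n⇒0<n∸m lj<kj) (part≤∑ℕ (λ a → k a ∸ l a) j)))
      ... | no  lj≮kj = inj₁ (∏ℕ-zero _ j (≡.trans (≡.cong (binomSel k j j) lj≡kj) (binomSel-top k j (2≤k j))))
        where
        lj≡kj : l j ≡ k j
        lj≡kj = ≤-antisym (proj₂ (l∈box j)) (≮⇒≥ lj≮kj)

    before at after : Fin r → Carrier
    before a = B a * A a ^ (k a ∸ 1)
    at a     = t * A a ^ (k a ∸ 1)
    after a  = A a ^ k a

    sum-over-box : ∀ j → Σ (List.map (λ l → ∏ (λ a → weight j a (l a))) (box r k)) ≈ ∏ (λ a → bySide j a (before a) (at a) (after a))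
    sum-over-box j = trans (box-factorise r k (weight j)) (∏-cong {r} (λ a →
      Coordinate.coordinate-sum t (A a) (B a) (p a) (A≈B+t a) (p-suc a)
        (toℕ a ℕ.<ᵇ toℕ j) (toℕ a ℕ.≡ᵇ toℕ j) (k a) (2≤k a)))

    at+before : ∀ a → at a + before a ≈ after a
    at+before a with k a | 2≤k a
    ... | suc K | _ = begin
      t * A a ^ K + B a * A a ^ K   ≈⟨ distribʳ (A a ^ K) t (B a) ⟨
      (t + B a) * A a ^ K          ≈⟨ *-congʳ (trans (+-comm t (B a)) (sym (A≈B+t a))) ⟩
      A a * A a ^ K                ∎

    ∏before≈∏after : ∏ before ≈ ∏ after
    ∏before≈∏after = begin
      ∏ before                                  ≈⟨ ∏-distrib-* {r} B (λ a → A a ^ (k a ∸ 1)) ⟩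
      ∏ B * ∏ (λ a → A a ^ (k a ∸ 1))          ≈⟨ *-congʳ ∏B≈∏A ⟩
      ∏ A * ∏ (λ a → A a ^ (k a ∸ 1))          ≈⟨ ∏-distrib-* {r} A (λ a → A a ^ (k a ∸ 1)) ⟨
      ∏ (λ a → A a * A a ^ (k a ∸ 1))          ≈⟨ ∏-cong {r} A*A^[k-1] ⟩
      ∏ after                                   ∎
      where
      A*A^[k-1] : ∀ a → A a * A a ^ (k a ∸ 1) ≈ after a
      A*A^[k-1] a with k a | 2≤k a
      ... | suc K | _ = refl

    relation : t * ∑[ j < r ] Σ (List.map (summand j) (box r k)) ≈ 0#
    relation = +-cancel-0 _ (∏ after) (begin
      t * ∑[ j < r ] Σ (List.map (summand j) (box r k)) + ∏ after
        ≈⟨ +-cong (*-distribˡ-sum {r} t _) (sym ∏before≈∏after) ⟩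
      ∑[ j < r ] (t * Σ (List.map (summand j) (box r k))) + ∏ before
        ≈⟨ +-congʳ (sum-cong-≋ {r} (λ j → trans (Σ-*ˡ t (summand j) (box r k))
             (trans (Σ-congᴬ (All.map (λ {l} → t-summand j l) (box-InBox r k))) (sum-over-box j)))) ⟩
      ∑[ j < r ] ∏ (λ a → bySide j a (before a) (at a) (after a)) + ∏ before
        ≈⟨ telescope before at after at+before ⟩
      ∏ after ∎)

module InCharZeroField {c ℓ : Level} (F : CharZeroField c ℓ) where
  open CharZeroField F
  open InCommutativeRing commutativeRing
  open import Relation.Binary.Reasoning.Setoid setoid
  open import Algebra.Properties.Semiring.Sum semiring using (sum; sum-syntax; sum-cong-≋)
  open import Algebra.Properties.CommutativeMonoid.Sum *-commutativeMonoid
    using () renaming (sum to ∏; ∑-distrib-+ to ∏-distrib-*)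
  open import Algebra.Properties.Semiring.Exp semiring using (_^_; ^-assocʳ; ^-congʳ)
  open import Algebra.Properties.CommutativeSemiring.Exp commutativeSemiring using (^-distrib-*)
  open import Algebra.Solver.Ring.NaturalCoefficients.Default commutativeSemiring

  1≉0 : ¬ (1# ≈ 0#)
  1≉0 1≈0 = charZero 0 (trans (+-identityʳ 1#) 1≈0)

  ⁻¹-unique : ∀ x y → x * y ≈ 1# → x ⁻¹ ≈ y
  ⁻¹-unique x y x*y≈1 = begin
    x ⁻¹               ≈⟨ *-identityˡ _ ⟨
    1# * x ⁻¹          ≈⟨ *-congʳ (trans (sym x*y≈1) (*-comm x y)) ⟩
    (y * x) * x ⁻¹     ≈⟨ *-assoc y x _ ⟩
    y * (x * x ⁻¹)     ≈⟨ *-congˡ (⁻¹-inverse x x≉0) ⟩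
    y * 1#             ≈⟨ *-identityʳ y ⟩
    y                  ∎
    where
    x≉0 : ¬ (x ≈ 0#)
    x≉0 x≈0 = 1≉0 (trans (sym x*y≈1) (trans (*-congʳ x≈0) (zeroˡ y)))

  cancel : ∀ t X → ¬ (t ≈ 0#) → t * X ≈ 0# → X ≈ 0#
  cancel t X t≉0 t*X≈0 = begin
    X                    ≈⟨ *-identityˡ X ⟨
    1# * X               ≈⟨ *-congʳ (⁻¹-inverse t t≉0) ⟨
    (t * t ⁻¹) * X       ≈⟨ solve 3 (λ t s x → (t :* s) :* x := s :* (t :* x)) refl t (t ⁻¹) X ⟩
    t ⁻¹ * (t * X)       ≈⟨ *-congˡ t*X≈0 ⟩
    t ⁻¹ * 0#            ≈⟨ zeroʳ _ ⟩
    0#                   ∎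

  x+[1-x] : ∀ x → x + (1# - x) ≈ 1#
  x+[1-x] x = begin
    x + (1# - x)     ≈⟨ +-congˡ (+-comm 1# (- x)) ⟩
    x + (- x + 1#)   ≈⟨ +-assoc x (- x) 1# ⟨
    (x - x) + 1#     ≈⟨ +-congʳ (-‿inverseʳ x) ⟩
    0# + 1#          ≈⟨ +-identityˡ 1# ⟩
    1#               ∎

  module AtRoot (n : ℕ) (ζ : Carrier) (ζ-primitive : IsPrimitiveRoot F n ζ) where

    t : Carrier
    t = 1# - ζ

    1-ζ^m≉0 : ∀ m → 0 < m → m < n → ¬ (1# - ζ ^ m ≈ 0#)
    1-ζ^m≉0 m 0<m m<n 1-ζ^m≈0 = proj₂ ζ-primitive m 0<m m<n (begin
      pow commutativeRing ζ m   ≡⟨ pow≡^ ζ m ⟩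
      ζ ^ m                     ≈⟨ +-identityʳ _ ⟨
      ζ ^ m + 0#                ≈⟨ +-congˡ 1-ζ^m≈0 ⟨
      ζ ^ m + (1# - ζ ^ m)      ≈⟨ x+[1-x] (ζ ^ m) ⟩
      1#                        ∎)

    factor : ∀ {r} → (Fin r → ℕ) → Fin r → ℕ → Carrier
    factor m a x = pow commutativeRing ζ ((x ∸ 1) ℕ.* m a) * (pow commutativeRing (qint F ζ (m a)) x ⁻¹)

    contribution : ∀ {r} → (k m : Fin r → ℕ) → Fin r → (Fin r → ℕ) → Carrier
    contribution {r} k m j l =
      nc (coeff F k j l) * (pow commutativeRing t ((sumFin k ∸ sumFin l) ∸ 1) * Π (List.map (λ a → factor m a (l a)) (allFin r)))

    relationLHS-by-composition : ∀ {r} (k : Fin r → ℕ) →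
      relationLHS F n k ζ ≈ Σ (List.map (λ m → Σ (List.map (λ j → Σ (List.map (contribution k m j) (box r k))) (allFin r))) (compositions r n))
    relationLHS-by-composition {r} k = begin
      relationLHS F n k ζ
        ≈⟨ Σ-cong js (λ j → Σ-cong ls (λ l → distribute j l)) ⟩
      Σ (List.map (λ j → Σ (List.map (λ l → Σ (List.map (λ m → contribution k m j l) ms)) ls)) js)
        ≈⟨ Σ-cong js (λ j → Σ-swap (λ l m → contribution k m j l) ls ms) ⟩
      Σ (List.map (λ j → Σ (List.map (λ m → Σ (List.map (contribution k m j) ls)) ms)) js)
        ≈⟨ Σ-swap (λ j m → Σ (List.map (contribution k m j) ls)) js ms ⟩
      Σ (List.map (λ m → Σ (List.map (λ j → Σ (List.map (contribution k m j) ls)) js)) ms) ∎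
      where
      js = allFin r
      ls = box r k
      ms = compositions r n
      distribute : ∀ j l → nc (coeff F k j l) * (pow commutativeRing t ((sumFin k ∸ sumFin l) ∸ 1) * omega F n l ζ)
                           ≈ Σ (List.map (λ m → contribution k m j l) ms)
      distribute j l = trans (*-congˡ (Σ-*ˡ _ _ ms)) (Σ-*ˡ _ _ ms)

    module Composition {r} (k : Fin (suc (suc r)) → ℕ) (2≤k : ∀ a → 2 ≤ k a)
                       (m : Fin (suc (suc r)) → ℕ) (m-composition : IsComposition n m) where

      -- The parts sum to n and, as r ≥ 2, each is below n; hence t ≠ 0.
      ∑m≡n : ∑ℕ m ≡ n
      ∑m≡n = ≡.trans (≡.sym (foldr-allFin ℕ._+_ 0 m)) (proj₁ m-composition)

      m<n : ∀ a → m a < n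
      m<n a = ≡.subst (m a <_) ∑m≡n (part<∑ℕ m (proj₂ m-composition) a)

      t≉0 : ¬ (t ≈ 0#)
      t≉0 t≈0 = 1-ζ^m≉0 1 (s≤s z≤n) (ℕ.≤-trans (s≤s (proj₂ m-composition fzero)) (m<n fzero))
        (trans (+-congˡ (-‿cong (*-identityʳ ζ))) t≈0)

      u : Fin (suc (suc r)) → Carrier
      u a = 1# - ζ ^ m a

      Q A B : Fin (suc (suc r)) → Carrier
      Q a = qint F ζ (m a)
      A a = Q a ⁻¹
      B a = ζ ^ m a * A a

      Q*t≈u : ∀ a → Q a * t ≈ u a
      Q*t≈u a = begin
        (1# - pow commutativeRing ζ (m a)) * t ⁻¹ * t   ≡⟨ ≡.cong (λ z → (1# - z) * t ⁻¹ * t) (pow≡^ ζ (m a)) ⟩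
        u a * t ⁻¹ * t                                  ≈⟨ *-assoc (u a) (t ⁻¹) t ⟩
        u a * (t ⁻¹ * t)                                ≈⟨ *-congˡ (trans (*-comm (t ⁻¹) t) (⁻¹-inverse t t≉0)) ⟩
        u a * 1#                                        ≈⟨ *-identityʳ (u a) ⟩
        u a                                             ∎

      Q*A≈1 : ∀ a → Q a * A a ≈ 1#
      Q*A≈1 a = ⁻¹-inverse (Q a) Q≉0
        where
        Q≉0 : ¬ (Q a ≈ 0#)
        Q≉0 Q≈0 = 1-ζ^m≉0 (m a) (proj₂ m-composition a) (m<n a) (trans (sym (Q*t≈u a)) (trans (*-congʳ Q≈0) (zeroˡ t)))

      -- 1/[m_a] = ζ^{m_a}/[m_a] + (1 - ζ^{m_a})/[m_a] = B_a + t.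
      A≈B+t : ∀ a → A a ≈ B a + t
      A≈B+t a = begin
        A a                           ≈⟨ *-identityˡ (A a) ⟨
        1# * A a                      ≈⟨ *-congʳ (x+[1-x] (ζ ^ m a)) ⟨
        (ζ ^ m a + u a) * A a         ≈⟨ distribʳ (A a) (ζ ^ m a) (u a) ⟩
        B a + u a * A a               ≈⟨ +-congˡ (*-congʳ (Q*t≈u a)) ⟨
        B a + Q a * t * A a           ≈⟨ +-congˡ (solve 3 (λ q t a → q :* t :* a := t :* (q :* a)) refl (Q a) t (A a)) ⟩
        B a + t * (Q a * A a)         ≈⟨ +-congˡ (trans (*-congˡ (Q*A≈1 a)) (*-identityʳ t)) ⟩
        B a + t                       ∎

      p : Fin (suc (suc r)) → ℕ → Carrier
      p = factor m

      p-suc : ∀ a i → p a (suc i) ≈ A a * B a ^ i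
      p-suc a i = begin
        pow commutativeRing ζ (i ℕ.* m a) * (pow commutativeRing (Q a) (suc i) ⁻¹)
          ≡⟨ ≡.cong₂ (λ x y → x * (y ⁻¹)) (pow≡^ ζ (i ℕ.* m a)) (pow≡^ (Q a) (suc i)) ⟩
        ζ ^ (i ℕ.* m a) * ((Q a ^ suc i) ⁻¹)
          ≈⟨ *-cong (trans (^-congʳ ζ (ℕ.*-comm i (m a))) (sym (^-assocʳ ζ (m a) i)))
                    (⁻¹-unique (Q a ^ suc i) (A a ^ suc i) (^-inverse (Q*A≈1 a) (suc i))) ⟩
        (ζ ^ m a) ^ i * (A a * A a ^ i)
          ≈⟨ solve 3 (λ z a w → z :* (a :* w) := a :* (z :* w)) refl ((ζ ^ m a) ^ i) (A a) (A a ^ i) ⟩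
        A a * ((ζ ^ m a) ^ i * A a ^ i)
          ≈⟨ *-congˡ (^-distrib-* (ζ ^ m a) (A a) i) ⟨
        A a * B a ^ i ∎

      -- ζ^n = 1 makes the products of the A's and of the B's agree.
      ∏B≈∏A : ∏ B ≈ ∏ A
      ∏B≈∏A = begin
        ∏ B                              ≈⟨ ∏-distrib-* (λ a → ζ ^ m a) A ⟩
        ∏ (λ a → ζ ^ m a) * ∏ A          ≈⟨ *-congʳ (^-∑ℕ ζ m) ⟨
        ζ ^ ∑ℕ m * ∏ A                   ≡⟨ ≡.cong (λ e → ζ ^ e * ∏ A) ∑m≡n ⟩
        ζ ^ n * ∏ A                      ≡⟨ ≡.cong (_* ∏ A) (≡.sym (pow≡^ ζ n)) ⟩
        pow commutativeRing ζ n * ∏ A    ≈⟨ *-congʳ (proj₁ ζ-primitive) ⟩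
        1# * ∏ A                         ≈⟨ *-identityˡ (∏ A) ⟩
        ∏ A                              ∎

      open ForComposition k 2≤k t A B p A≈B+t p-suc ∏B≈∏A using (summand; relation)

      contribution≡summand : ∀ j l → contribution k m j l ≡ summand j l
      contribution≡summand j l = ≡.cong₂ _*_
        (≡.cong nc (foldr-allFin ℕ._*_ 1 (λ a → binomSel k j a (l a))))
        (≡.cong₂ _*_ (pow≡^ t ((sumFin k ∸ sumFin l) ∸ 1)) (foldr-allFin _*_ 1# (λ a → p a (l a))))

      contributions-vanish : Σ (List.map (λ j → Σ (List.map (contribution k m j) (box (suc (suc r)) k))) (allFin (suc (suc r)))) ≈ 0#
      contributions-vanish = begin
        Σ (List.map (λ j → Σ (List.map (contribution k m j) (box _ k))) (allFin _))
          ≡⟨ foldr-allFin _+_ 0# (λ j → Σ (List.map (contribution k m j) (box _ k))) ⟩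
        ∑[ j < suc (suc r) ] Σ (List.map (contribution k m j) (box _ k))
          ≈⟨ sum-cong-≋ {suc (suc r)} (λ j → Σ-cong (box _ k) (λ l → reflexive (contribution≡summand j l))) ⟩
        ∑[ j < suc (suc r) ] Σ (List.map (summand j) (box _ k))
          ≈⟨ cancel t _ t≉0 relation ⟩
        0# ∎

theorem5p1 : {c ℓ : Level} (F : CharZeroField c ℓ) (r : ℕ) (k : Fin r → ℕ) →
    2 ≤ r → (∀ p → 2 ≤ k p) →
    (n : ℕ) → 1 ≤ n → (ζ : CharZeroField.Carrier F) → IsPrimitiveRoot F n ζ →
    CharZeroField._≈_ F (relationLHS F n k ζ) (CharZeroField.0# F)
theorem5p1 F (suc (suc r)) k (s≤s (s≤s _)) 2≤k n _ ζ ζ-primitive =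
  trans (relationLHS-by-composition k)
        (Σ-zeroᴬ (All.map (λ {m} → Composition.contributions-vanish k 2≤k m) (compositions-valid _ n)))
  where
  open CharZeroField F using (trans)
  open InCommutativeRing (CharZeroField.commutativeRing F) using (Σ-zeroᴬ)
  open InCharZeroField F
  open AtRoot n ζ ζ-primitive
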